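{- For all integers $1\le k\le n$ and every $\pi\in\Pi(n)$, \[ |S_{\mathrm{out}}(\pi;k)| = |S_{\mathrm{in}}(\pi;k)| = (n-k+2)(2^{k-1}-1) - k + 2. \]
   Context: $\Pi(n)$ denotes the set of permutations of $\{1,\dots,n\}$, each regarded as a sequence $\pi=(\pi_1,\dots,\pi_n)$. A TDRL operation on a sequence $(x_1,\dots,x_m)$ of distinct symbols is specified by a binary pattern $b\in\{0,1\}^m$. Its result is the concatenation of the subsequence $(x_i:b_i=1)$ with the subsequence $(x_i:b_i=0)$, each taken with indices in increasing order. A bounded TDRL operation of width $k$ on $\pi\in\Pi(n)$ proceeds as follows: choose $j$ with $1\le j\le n-k+1$, apply a TDRL operation to the segment $(\pi_j,\dots,\pi_{j+k-1})$ of $k$ consecutive entries, and replace this segment by the result, leaving all other entries in place. $S_{\mathrm{out}}(\pi;k)$ is the set of all permutations obtainable from $\pi$ by one bounded TDRL operation of width $k$. $S_{\mathrm{in}}(\pi;k)=\{\rho\in\Pi(n): \pi\in S_{\mathrm{out}}(\rho;k)\}$. -}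

module Defs where

open import Data.Nat using (ℕ; suc; _+_)
open import Data.Bool using (Bool; true; false)
open import Data.List using (List; []; _∷_; _++_; length; upTo; map)
open import Data.List.Relation.Binary.Permutation.Propositional using (_↭_)
open import Data.List.Relation.Unary.Unique.Propositional using (Unique)
open import Data.List.Membership.Propositional using (_∈_)
open import Data.Product using (Σ; _×_; ∃-syntax)
open import Function.Bundles using (_⇔_)
open import Relation.Binary.PropositionalEquality using (_≡_)

IsPerm : ℕ → List ℕ → Set
IsPerm n π = π ↭ map suc (upTo n)

select : {A : Set} → Bool → List A → List Bool → List A
select c []       _        = []
select c (x ∷ xs) []       = []
select true  (x ∷ xs) (true  ∷ bs) = x ∷ select true xs bs
select true  (x ∷ xs) (false ∷ bs) = select true xs bs
select false (x ∷ xs) (true  ∷ bs) = select false xs bs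
select false (x ∷ xs) (false ∷ bs) = x ∷ select false xs bs

tdrl : {A : Set} → List A → List Bool → List A
tdrl xs bs = select true xs bs ++ select false xs bs

-- ρ is obtained from π by one bounded TDRL operation of width k:
-- π = pre ++ seg ++ post with |seg| = k (so j = |pre| + 1 ranges over 1..n-k+1),
-- b ∈ {0,1}^k, and ρ = pre ++ tdrl seg b ++ post.
Sout : ℕ → List ℕ → List ℕ → Set
Sout k π ρ = ∃[ pre ] ∃[ seg ] ∃[ post ] ∃[ bs ]
  (π ≡ pre ++ seg ++ post × length seg ≡ k × length bs ≡ k
   × ρ ≡ pre ++ tdrl seg bs ++ post)

Sin : ℕ → ℕ → List ℕ → List ℕ → Set
Sin n k π ρ = IsPerm n ρ × Sout k ρ π

HasSize : (List ℕ → Set) → ℕ → Set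
HasSize P N = ∃[ xs ] (Unique xs × (∀ x → (x ∈ xs) ⇔ P x) × length xs ≡ N)

-- Fix the window width k = 1 + k′.  Instead of counting S_out(π;k) directly, we
-- enumerate it canonically: a result ρ of one width-k operation on x ∷ π either
-- keeps x in front (and is then x ∷ ρ' for a result ρ' on π), or the window starts
-- at x, its pattern starts with 0 and contains a 1 (so x really moves).  Results
-- of the second kind are pairwise distinct and distinct from those of the first.
-- This gives the recursion |E(x ∷ π)| = |E(π)| + (2^min(k′,|π|) − 1), which sums
-- to (n − k + 2)(2^(k−1) − 1) + 2 − k.
--
-- The enumeration only uses five structural properties of the operation
-- (IsWindowOp).  TDRL has them, and so does its inverse untdrl, which
-- redistributes a segment back according to the pattern; since S_in(π;k) is
-- exactly the set of results of one width-k untdrl operation on π, both counts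
-- follow from one generic theorem (bounded-size).
module Submission where

open import Defs
open import Data.Nat using (ℕ; zero; suc; _+_; _*_; _∸_; _^_; _≤_; _<_; z≤n; s≤s)
open import Data.Nat.Properties
  using (suc-injective; ≤-pred; ≤-reflexive; ≤-trans; <⇒≤; ≰⇒>; _≤?_; m≤n⇒m≤1+n; m≤m+n;
         m≤n⇒m<n∨m≡n; m≤n⇒m⊓n≡m; 1+n≰n; +-suc; +-identityʳ; m+n∸n≡m; m+n∸m≡n; m+[n∸m]≡n)
open import Data.Nat.Solver using (module +-*-Solver)
open import Data.Bool using (Bool; true; false)
open import Data.Bool.Properties using () renaming (_≟_ to _≟ᵇ_)
open import Data.List using (List; []; _∷_; _++_; length; map; take; drop; replicate; upTo)
open import Data.List.Properties
  using (++-assoc; ++-identityʳ; ++-cancelʳ; length-++; length-map; length-take; length-drop;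
         length-replicate; length-upTo; take-all; drop-all; take++drop≡id; ∷-injectiveˡ; ∷-injectiveʳ)
open import Data.List.Relation.Unary.All using (All; []; _∷_)
open import Data.List.Relation.Unary.Any using (here; there)
open import Data.List.Relation.Unary.AllPairs using ([]; _∷_)
open import Data.List.Relation.Unary.Unique.Propositional using (Unique)
import Data.List.Relation.Unary.Unique.Propositional.Properties as Unique
open import Data.List.Membership.Propositional using (_∈_; _∉_)
open import Data.List.Membership.Propositional.Properties using (∈-map⁺; ∈-map⁻; ∈-++⁺ˡ; ∈-++⁺ʳ; ∈-++⁻)
open import Data.List.Membership.DecPropositional _≟ᵇ_ using (_∈?_)
open import Data.List.Relation.Binary.Permutation.Propositional using (_↭_; ↭-refl; ↭-sym; ↭-trans; ↭-prep; ↭⇒↭ₛ)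
open import Data.List.Relation.Binary.Permutation.Propositional.Properties using (↭-length; shift; ++⁺ˡ; ++⁺ʳ)
import Data.List.Relation.Binary.Permutation.Setoid.Properties as PermSetoid
open import Data.Product using (_×_; _,_; ∃-syntax)
open import Data.Sum using (_⊎_; inj₁; inj₂)
open import Data.Empty using (⊥-elim)
open import Function.Bundles using (_⇔_; mk⇔)
open import Function.Properties.Equivalence using () renaming (sym to ⇔-sym; trans to ⇔-trans)
open import Relation.Binary.PropositionalEquality
  using (_≡_; _≢_; refl; sym; trans; cong; cong₂; subst; subst₂; setoid; module ≡-Reasoning)
open import Relation.Nullary using (¬_; yes; no)

open ≡-Reasoning

private
  variable
    A B : Set

Unique-resp-↭ : {xs ys : List A} → xs ↭ ys → Unique xs → Unique ys
Unique-resp-↭ {A} p = PermSetoid.Unique-resp-↭ (setoid A) (↭⇒↭ₛ p)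

map-Unique : (f : A → B) (xs : List A) → (∀ {a b} → a ∈ xs → b ∈ xs → f a ≡ f b → a ≡ b) →
             Unique xs → Unique (map f xs)
map-Unique f [] inj [] = []
map-Unique f (a ∷ xs) inj (a∉ ∷ u) =
  image-apart xs a∉ (λ b∈ → inj (here refl) (there b∈)) ∷ map-Unique f xs (λ p q → inj (there p) (there q)) u
  where
  image-apart : ∀ ys → All (a ≢_) ys → (∀ {b} → b ∈ ys → f a ≡ f b → a ≡ b) → All (f a ≢_) (map f ys)
  image-apart [] [] _ = []
  image-apart (y ∷ ys) (a≢y ∷ a≢ys) inj′ =
    (λ e → a≢y (inj′ (here refl) e)) ∷ image-apart ys a≢ys (λ b∈ → inj′ (there b∈))

cons-of-length : {xs : List A} {m : ℕ} → length xs ≡ suc m → ∃[ z ] ∃[ zs ] (xs ≡ z ∷ zs)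
cons-of-length {xs = z ∷ zs} _ = z , zs , refl

prefix-before : (as cs : List A) {x : A} {bs ds : List A} → x ∉ as → x ∉ cs →
                as ++ x ∷ bs ≡ cs ++ x ∷ ds → as ≡ cs
prefix-before [] [] _ _ _ = refl
prefix-before [] (c ∷ cs) _ x∉cs eq = ⊥-elim (x∉cs (here (∷-injectiveˡ eq)))
prefix-before (a ∷ as) [] x∉as _ eq = ⊥-elim (x∉as (here (sym (∷-injectiveˡ eq))))
prefix-before (a ∷ as) (c ∷ cs) x∉as x∉cs eq =
  cong₂ _∷_ (∷-injectiveˡ eq) (prefix-before as cs (λ p → x∉as (there p)) (λ p → x∉cs (there p)) (∷-injectiveʳ eq))

take-length-++ : (xs ys : List A) → take (length xs) (xs ++ ys) ≡ xs
take-length-++ [] ys = refl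
take-length-++ (x ∷ xs) ys = cong (x ∷_) (take-length-++ xs ys)

drop-length-++ : (xs ys : List A) → drop (length xs) (xs ++ ys) ≡ ys
drop-length-++ [] ys = refl
drop-length-++ (x ∷ xs) ys = drop-length-++ xs ys

take-++-≤ : (w p : List A) (m : ℕ) → length w ≤ m → take m (w ++ p) ≡ w ++ take (m ∸ length w) p
take-++-≤ [] p m _ = refl
take-++-≤ (x ∷ w) p (suc m) (s≤s le) = cong (x ∷_) (take-++-≤ w p m le)

drop-++-≤ : (w p : List A) (m : ℕ) → length w ≤ m → drop m (w ++ p) ≡ drop (m ∸ length w) p
drop-++-≤ [] p m _ = refl
drop-++-≤ (x ∷ w) p (suc m) (s≤s le) = drop-++-≤ w p m le

select-⊆ : ∀ c (xs : List A) bs {y} → y ∈ select c xs bs → y ∈ xs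
select-⊆ c [] bs ()
select-⊆ c (x ∷ xs) [] ()
select-⊆ true (x ∷ xs) (true ∷ bs) (here p) = here p
select-⊆ true (x ∷ xs) (true ∷ bs) (there p) = there (select-⊆ true xs bs p)
select-⊆ true (x ∷ xs) (false ∷ bs) p = there (select-⊆ true xs bs p)
select-⊆ false (x ∷ xs) (true ∷ bs) p = there (select-⊆ false xs bs p)
select-⊆ false (x ∷ xs) (false ∷ bs) (here p) = here p
select-⊆ false (x ∷ xs) (false ∷ bs) (there p) = there (select-⊆ false xs bs p)

select-true-injective : (xs : List A) → Unique xs → ∀ bs bs′ → length bs ≡ length xs → length bs′ ≡ length xs →
                        select true xs bs ≡ select true xs bs′ → bs ≡ bs′
select-true-injective [] _ [] [] _ _ _ = refl
select-true-injective (x ∷ xs) (_ ∷ u) (true ∷ bs) (true ∷ bs′) lb lb′ eq =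
  cong (true ∷_) (select-true-injective xs u bs bs′ (suc-injective lb) (suc-injective lb′) (∷-injectiveʳ eq))
select-true-injective (x ∷ xs) (_ ∷ u) (false ∷ bs) (false ∷ bs′) lb lb′ eq =
  cong (false ∷_) (select-true-injective xs u bs bs′ (suc-injective lb) (suc-injective lb′) eq)
select-true-injective (x ∷ xs) u (true ∷ bs) (false ∷ bs′) _ _ eq =
  ⊥-elim (Unique.Unique[x∷xs]⇒x∉xs u (select-⊆ true xs bs′ (subst (x ∈_) eq (here refl))))
select-true-injective (x ∷ xs) u (false ∷ bs) (true ∷ bs′) _ _ eq =
  ⊥-elim (Unique.Unique[x∷xs]⇒x∉xs u (select-⊆ true xs bs (subst (x ∈_) (sym eq) (here refl))))

select-true-nonempty : (xs : List A) (bs : List Bool) → true ∈ bs → length bs ≡ length xs →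
                       ∃[ y ] ∃[ ys ] (select true xs bs ≡ y ∷ ys)
select-true-nonempty (x ∷ xs) (true ∷ bs) _ _ = x , select true xs bs , refl
select-true-nonempty (x ∷ xs) (false ∷ bs) (there p) lb = select-true-nonempty xs bs p (suc-injective lb)

select-true-pad : (w t : List A) (bs : List Bool) → length bs ≡ length w →
                  select true (w ++ t) (bs ++ replicate (length t) false) ≡ select true w bs
select-true-pad [] [] [] _ = refl
select-true-pad [] (y ∷ t) [] _ = select-true-pad [] t [] refl
select-true-pad (x ∷ w) t (true ∷ bs) lb = cong (x ∷_) (select-true-pad w t bs (suc-injective lb))
select-true-pad (x ∷ w) t (false ∷ bs) lb = select-true-pad w t bs (suc-injective lb)

select-false-pad : (w t : List A) (bs : List Bool) → length bs ≡ length w →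
                   select false (w ++ t) (bs ++ replicate (length t) false) ≡ select false w bs ++ t
select-false-pad [] [] [] _ = refl
select-false-pad [] (y ∷ t) [] _ = cong (y ∷_) (select-false-pad [] t [] refl)
select-false-pad (x ∷ w) t (true ∷ bs) lb = select-false-pad w t bs (suc-injective lb)
select-false-pad (x ∷ w) t (false ∷ bs) lb = cong (x ∷_) (select-false-pad w t bs (suc-injective lb))

tdrl-pad : (w t : List A) (bs : List Bool) → length bs ≡ length w →
           tdrl (w ++ t) (bs ++ replicate (length t) false) ≡ tdrl w bs ++ t
tdrl-pad w t bs lb = begin
    select true (w ++ t) pad ++ select false (w ++ t) pad
  ≡⟨ cong₂ _++_ (select-true-pad w t bs lb) (select-false-pad w t bs lb) ⟩
    select true w bs ++ (select false w bs ++ t)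
  ≡⟨ ++-assoc (select true w bs) (select false w bs) t ⟨
    tdrl w bs ++ t ∎
  where pad = bs ++ replicate (length t) false

-- On a duplicate-free segment x ∷ w, patterns starting with 0 are determined by their
-- result: x is the first entry after the 1-subsequence, which fixes that subsequence.
tdrl-0-injective : ∀ (x : A) w bs bs′ → Unique (x ∷ w) → length bs ≡ length w → length bs′ ≡ length w →
                   tdrl (x ∷ w) (false ∷ bs) ≡ tdrl (x ∷ w) (false ∷ bs′) → bs ≡ bs′
tdrl-0-injective x w bs bs′ u@(_ ∷ uw) lb lb′ eq =
  select-true-injective w uw bs bs′ lb lb′
    (prefix-before (select true w bs) (select true w bs′) (x∉ bs) (x∉ bs′) eq)
  where
  x∉ : ∀ cs → x ∉ select true w cs
  x∉ cs p = Unique.Unique[x∷xs]⇒x∉xs u (select-⊆ true w cs p)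

-- If the pattern starts with 0 and contains a 1, the first entry x is displaced:
-- the result starts with an entry of w, which differs from x.
tdrl-0-displaces : ∀ (x : A) w bs → Unique (x ∷ w) → true ∈ bs → length bs ≡ length w →
                   ∃[ y ] ∃[ l ] (tdrl (x ∷ w) (false ∷ bs) ≡ y ∷ l × y ≢ x)
tdrl-0-displaces x w bs u one lb with select-true-nonempty w bs one lb
... | y , ys , e = y , ys ++ x ∷ select false w bs , cong (_++ x ∷ select false w bs) e , y≢x
  where
  y≢x : y ≢ x
  y≢x y≡x = Unique.Unique[x∷xs]⇒x∉xs u
    (select-⊆ true w bs (subst (_∈ select true w bs) y≡x (subst (y ∈_) (sym e) (here refl))))

ones : List Bool → ℕ
ones [] = 0
ones (true ∷ bs) = suc (ones bs)
ones (false ∷ bs) = ones bs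

zeros : List Bool → ℕ
zeros [] = 0
zeros (true ∷ bs) = zeros bs
zeros (false ∷ bs) = suc (zeros bs)

ones+zeros : ∀ bs → ones bs + zeros bs ≡ length bs
ones+zeros [] = refl
ones+zeros (true ∷ bs) = cong suc (ones+zeros bs)
ones+zeros (false ∷ bs) = trans (+-suc (ones bs) (zeros bs)) (cong suc (ones+zeros bs))

merge : List Bool → List A → List A → List A
merge [] u v = u ++ v
merge (true ∷ bs) (x ∷ u) v = x ∷ merge bs u v
merge (true ∷ bs) [] v = merge bs [] v
merge (false ∷ bs) u (y ∷ v) = y ∷ merge bs u v
merge (false ∷ bs) u [] = merge bs u []

untdrl : List A → List Bool → List A
untdrl s bs = merge bs (take (ones bs) s) (drop (ones bs) s)

merge-↭ : ∀ bs (u v : List A) → merge bs u v ↭ u ++ v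
merge-↭ [] u v = ↭-refl
merge-↭ (true ∷ bs) (x ∷ u) v = ↭-prep x (merge-↭ bs u v)
merge-↭ (true ∷ bs) [] v = merge-↭ bs [] v
merge-↭ (false ∷ bs) u (y ∷ v) = ↭-trans (↭-prep y (merge-↭ bs u v)) (↭-sym (shift y u v))
merge-↭ (false ∷ bs) u [] = merge-↭ bs u []

untdrl-↭ : ∀ (s : List A) bs → untdrl s bs ↭ s
untdrl-↭ s bs = subst (untdrl s bs ↭_) (take++drop≡id (ones bs) s) (merge-↭ bs _ _)

length-untdrl : ∀ (s : List A) bs → length (untdrl s bs) ≡ length s
length-untdrl s bs = ↭-length (untdrl-↭ s bs)

select-true-merge : ∀ bs (u v : List A) → length u ≡ ones bs → length v ≡ zeros bs → select true (merge bs u v) bs ≡ u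
select-true-merge [] [] [] _ _ = refl
select-true-merge (true ∷ bs) (x ∷ u) v lu lv = cong (x ∷_) (select-true-merge bs u v (suc-injective lu) lv)
select-true-merge (false ∷ bs) u (y ∷ v) lu lv = select-true-merge bs u v lu (suc-injective lv)

select-false-merge : ∀ bs (u v : List A) → length u ≡ ones bs → length v ≡ zeros bs → select false (merge bs u v) bs ≡ v
select-false-merge [] [] [] _ _ = refl
select-false-merge (true ∷ bs) (x ∷ u) v lu lv = select-false-merge bs u v (suc-injective lu) lv
select-false-merge (false ∷ bs) u (y ∷ v) lu lv = cong (y ∷_) (select-false-merge bs u v lu (suc-injective lv))

tdrl-untdrl : ∀ (s : List A) bs → length bs ≡ length s → tdrl (untdrl s bs) bs ≡ s
tdrl-untdrl s bs lb = begin
    tdrl (merge bs u v) bs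
  ≡⟨ cong₂ _++_ (select-true-merge bs u v lu lv) (select-false-merge bs u v lu lv) ⟩
    u ++ v
  ≡⟨ take++drop≡id (ones bs) s ⟩
    s ∎
  where
  u = take (ones bs) s
  v = drop (ones bs) s
  ones≤ : ones bs ≤ length s
  ones≤ = subst (ones bs ≤_) (trans (ones+zeros bs) lb) (m≤m+n (ones bs) (zeros bs))
  lu : length u ≡ ones bs
  lu = trans (length-take (ones bs) s) (m≤n⇒m⊓n≡m ones≤)
  lv : length v ≡ zeros bs
  lv = begin
      length v                        ≡⟨ length-drop (ones bs) s ⟩
      length s ∸ ones bs              ≡⟨ cong (_∸ ones bs) (trans (ones+zeros bs) lb) ⟨
      ones bs + zeros bs ∸ ones bs    ≡⟨ m+n∸m≡n (ones bs) (zeros bs) ⟩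
      zeros bs ∎

length-select-true : ∀ (s : List A) bs → length bs ≡ length s → length (select true s bs) ≡ ones bs
length-select-true [] [] _ = refl
length-select-true (x ∷ s) (true ∷ bs) lb = cong suc (length-select-true s bs (suc-injective lb))
length-select-true (x ∷ s) (false ∷ bs) lb = length-select-true s bs (suc-injective lb)

merge-select : ∀ (s : List A) bs → length bs ≡ length s → merge bs (select true s bs) (select false s bs) ≡ s
merge-select [] [] _ = refl
merge-select (x ∷ s) (true ∷ bs) lb = cong (x ∷_) (merge-select s bs (suc-injective lb))
merge-select (x ∷ s) (false ∷ bs) lb = cong (x ∷_) (merge-select s bs (suc-injective lb))

untdrl-tdrl : ∀ (s : List A) bs → length bs ≡ length s → untdrl (tdrl s bs) bs ≡ s
untdrl-tdrl s bs lb = begin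
    merge bs (take (ones bs) (S₁ ++ S₀)) (drop (ones bs) (S₁ ++ S₀))
  ≡⟨ cong (λ m → merge bs (take m (S₁ ++ S₀)) (drop m (S₁ ++ S₀))) (length-select-true s bs lb) ⟨
    merge bs (take (length S₁) (S₁ ++ S₀)) (drop (length S₁) (S₁ ++ S₀))
  ≡⟨ cong₂ (merge bs) (take-length-++ S₁ S₀) (drop-length-++ S₁ S₀) ⟩
    merge bs S₁ S₀
  ≡⟨ merge-select s bs lb ⟩
    s ∎
  where
  S₁ = select true s bs
  S₀ = select false s bs

length-tdrl : ∀ (s : List A) bs → length bs ≡ length s → length (tdrl s bs) ≡ length s
length-tdrl s bs lb = trans (sym (length-untdrl (tdrl s bs) bs)) (cong length (untdrl-tdrl s bs lb))

-- The properties of TDRL used by the enumeration transfer to untdrl, because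
-- untdrl is inverted by TDRL: zero-padding …
untdrl-pad : (w t : List A) (bs : List Bool) → length bs ≡ length w →
             untdrl (w ++ t) (bs ++ replicate (length t) false) ≡ untdrl w bs ++ t
untdrl-pad w t bs lb = begin
    untdrl (w ++ t) pad
  ≡⟨ cong (λ r → untdrl (r ++ t) pad) (tdrl-untdrl w bs lb) ⟨
    untdrl (tdrl s bs ++ t) pad
  ≡⟨ cong (λ r → untdrl r pad) (tdrl-pad s t bs ls) ⟨
    untdrl (tdrl (s ++ t) pad) pad
  ≡⟨ untdrl-tdrl (s ++ t) pad lpad ⟩
    s ++ t ∎
  where
  s = untdrl w bs
  pad = bs ++ replicate (length t) false
  ls : length bs ≡ length s
  ls = trans lb (sym (length-untdrl w bs))
  lpad : length pad ≡ length (s ++ t)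
  lpad = trans (length-++ bs) (trans (cong₂ _+_ ls (length-replicate (length t))) (sym (length-++ s)))

untdrl-cons : ∀ (x : A) w bs → Unique (x ∷ w) →
              ∃[ z ] ∃[ ρ ] (untdrl (x ∷ w) bs ≡ z ∷ ρ × Unique (z ∷ ρ) × length ρ ≡ length w)
untdrl-cons x w bs u with cons-of-length (length-untdrl (x ∷ w) bs)
... | z , ρ , e = z , ρ , e , Unique-resp-↭ (↭-sym perm) u , suc-injective (↭-length perm)
  where
  perm : z ∷ ρ ↭ x ∷ w
  perm = subst (_↭ x ∷ w) e (untdrl-↭ (x ∷ w) bs)

untdrl-0-injective : ∀ (x : A) w bs bs′ → Unique (x ∷ w) → length bs ≡ length w → length bs′ ≡ length w →
                     untdrl (x ∷ w) (false ∷ bs) ≡ untdrl (x ∷ w) (false ∷ bs′) → bs ≡ bs′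
untdrl-0-injective x w bs bs′ u lb lb′ eq with untdrl-cons x w (false ∷ bs) u
... | z , ρ , e , uzρ , lρ = tdrl-0-injective z ρ bs bs′ uzρ (trans lb (sym lρ)) (trans lb′ (sym lρ)) (begin
    tdrl (z ∷ ρ) (false ∷ bs)                     ≡⟨ cong (λ r → tdrl r (false ∷ bs)) e ⟨
    tdrl (untdrl (x ∷ w) (false ∷ bs)) (false ∷ bs)   ≡⟨ tdrl-untdrl (x ∷ w) (false ∷ bs) (cong suc lb) ⟩
    x ∷ w                                         ≡⟨ tdrl-untdrl (x ∷ w) (false ∷ bs′) (cong suc lb′) ⟨
    tdrl (untdrl (x ∷ w) (false ∷ bs′)) (false ∷ bs′) ≡⟨ cong (λ r → tdrl r (false ∷ bs′)) (trans (sym eq) e) ⟩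
    tdrl (z ∷ ρ) (false ∷ bs′) ∎)

untdrl-0-displaces : ∀ (x : A) w bs → Unique (x ∷ w) → true ∈ bs → length bs ≡ length w →
                     ∃[ z ] ∃[ ρ ] (untdrl (x ∷ w) (false ∷ bs) ≡ z ∷ ρ × z ≢ x)
untdrl-0-displaces x w bs u one lb with untdrl-cons x w (false ∷ bs) u
... | z , ρ , e , uzρ , lρ with tdrl-0-displaces z ρ bs uzρ one (trans lb (sym lρ))
...   | y , l , e′ , y≢z = z , ρ , e , z≢x
  where
  -- TDRL undoes untdrl, so its result x ∷ w starts with y, an entry different from z.
  y≡x : y ≡ x
  y≡x = ∷-injectiveˡ (begin
    y ∷ l                                         ≡⟨ e′ ⟨
    tdrl (z ∷ ρ) (false ∷ bs)                     ≡⟨ cong (λ r → tdrl r (false ∷ bs)) e ⟨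
    tdrl (untdrl (x ∷ w) (false ∷ bs)) (false ∷ bs)   ≡⟨ tdrl-untdrl (x ∷ w) (false ∷ bs) (cong suc lb) ⟩
    x ∷ w ∎)
  z≢x : z ≢ x
  z≢x z≡x = y≢z (trans y≡x (sym z≡x))

branch : List (List Bool) → List (List Bool) → List (List Bool)
branch xs ys = map (true ∷_) xs ++ map (false ∷_) ys

∈-branch⁻ : ∀ xs {ys v} → v ∈ branch xs ys →
            (∃[ a ] (a ∈ xs × v ≡ true ∷ a)) ⊎ (∃[ a ] (a ∈ ys × v ≡ false ∷ a))
∈-branch⁻ xs v∈ with ∈-++⁻ (map (true ∷_) xs) v∈
... | inj₁ p = inj₁ (∈-map⁻ (true ∷_) p)
... | inj₂ p = inj₂ (∈-map⁻ (false ∷_) p)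

∈-branch⁺ˡ : ∀ {xs} ys {a} → a ∈ xs → true ∷ a ∈ branch xs ys
∈-branch⁺ˡ ys a∈ = ∈-++⁺ˡ (∈-map⁺ (true ∷_) a∈)

∈-branch⁺ʳ : ∀ xs {ys a} → a ∈ ys → false ∷ a ∈ branch xs ys
∈-branch⁺ʳ xs a∈ = ∈-++⁺ʳ (map (true ∷_) xs) (∈-map⁺ (false ∷_) a∈)

branch-Unique : ∀ {xs ys} → Unique xs → Unique ys → Unique (branch xs ys)
branch-Unique uxs uys = Unique.++⁺ (Unique.map⁺ ∷-injectiveʳ uxs) (Unique.map⁺ ∷-injectiveʳ uys) apart
  where
  apart : ∀ {v} → ¬ (v ∈ map (true ∷_) _ × v ∈ map (false ∷_) _)
  apart (p , q) with ∈-map⁻ (true ∷_) p | ∈-map⁻ (false ∷_) q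
  ... | _ , _ , refl | _ , _ , ()

length-branch : ∀ xs ys → length (branch xs ys) ≡ length xs + length ys
length-branch xs ys =
  trans (length-++ (map (true ∷_) xs)) (cong₂ _+_ (length-map (true ∷_) xs) (length-map (false ∷_) ys))

patterns : ℕ → List (List Bool)
patterns zero = [] ∷ []
patterns (suc m) = branch (patterns m) (patterns m)

nonzero : ℕ → List (List Bool)
nonzero zero = []
nonzero (suc m) = branch (patterns m) (nonzero m)

patterns-length : ∀ m {bs} → bs ∈ patterns m → length bs ≡ m
patterns-length zero (here refl) = refl
patterns-length (suc m) p with ∈-branch⁻ (patterns m) p
... | inj₁ (a , a∈ , refl) = cong suc (patterns-length m a∈)
... | inj₂ (a , a∈ , refl) = cong suc (patterns-length m a∈)

nonzero-length : ∀ m {bs} → bs ∈ nonzero m → length bs ≡ m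
nonzero-length (suc m) p with ∈-branch⁻ (patterns m) p
... | inj₁ (a , a∈ , refl) = cong suc (patterns-length m a∈)
... | inj₂ (a , a∈ , refl) = cong suc (nonzero-length m a∈)

nonzero-has-one : ∀ m {bs} → bs ∈ nonzero m → true ∈ bs
nonzero-has-one (suc m) p with ∈-branch⁻ (patterns m) p
... | inj₁ (a , a∈ , refl) = here refl
... | inj₂ (a , a∈ , refl) = there (nonzero-has-one m a∈)

patterns-complete : ∀ bs → bs ∈ patterns (length bs)
patterns-complete [] = here refl
patterns-complete (true ∷ bs) = ∈-branch⁺ˡ _ (patterns-complete bs)
patterns-complete (false ∷ bs) = ∈-branch⁺ʳ _ (patterns-complete bs)

nonzero-complete : ∀ bs → true ∈ bs → bs ∈ nonzero (length bs)
nonzero-complete (true ∷ bs) _ = ∈-branch⁺ˡ _ (patterns-complete bs)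
nonzero-complete (false ∷ bs) (there one) = ∈-branch⁺ʳ _ (nonzero-complete bs one)

patterns-Unique : ∀ m → Unique (patterns m)
patterns-Unique zero = [] ∷ []
patterns-Unique (suc m) = branch-Unique (patterns-Unique m) (patterns-Unique m)

nonzero-Unique : ∀ m → Unique (nonzero m)
nonzero-Unique zero = []
nonzero-Unique (suc m) = branch-Unique (patterns-Unique m) (nonzero-Unique m)

patterns-count : ∀ m → length (patterns m) ≡ 2 ^ m
patterns-count zero = refl
patterns-count (suc m) = begin
  length (branch (patterns m) (patterns m))    ≡⟨ length-branch (patterns m) (patterns m) ⟩
  length (patterns m) + length (patterns m)    ≡⟨ cong₂ _+_ (patterns-count m) (patterns-count m) ⟩
  2 ^ m + 2 ^ m                                ≡⟨ cong (2 ^ m +_) (+-identityʳ (2 ^ m)) ⟨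
  2 ^ suc m ∎

-- Only the all-zero pattern is missing: 1 + |nonzero m| = 2^m.
nonzero-count : ∀ m → suc (length (nonzero m)) ≡ 2 ^ m
nonzero-count zero = refl
nonzero-count (suc m) = begin
  suc (length (branch (patterns m) (nonzero m)))   ≡⟨ cong suc (length-branch (patterns m) (nonzero m)) ⟩
  suc (length (patterns m) + length (nonzero m))   ≡⟨ +-suc (length (patterns m)) (length (nonzero m)) ⟨
  length (patterns m) + suc (length (nonzero m))   ≡⟨ cong₂ _+_ (patterns-count m) (nonzero-count m) ⟩
  2 ^ m + 2 ^ m                                    ≡⟨ cong (2 ^ m +_) (+-identityʳ (2 ^ m)) ⟨
  2 ^ suc m ∎

no-one⇒zeros : ∀ bs → ¬ (true ∈ bs) → bs ≡ replicate (length bs) false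
no-one⇒zeros [] _ = refl
no-one⇒zeros (true ∷ bs) no-one = ⊥-elim (no-one (here refl))
no-one⇒zeros (false ∷ bs) no-one = cong (false ∷_) (no-one⇒zeros bs (λ p → no-one (there p)))

record IsWindowOp {A : Set} (op : List A → List Bool → List A) : Set where
  field
    op-[] : op [] [] ≡ []
    op-1∷ : ∀ x w bs → op (x ∷ w) (true ∷ bs) ≡ x ∷ op w bs
    op-pad : ∀ w t bs → length bs ≡ length w → op (w ++ t) (bs ++ replicate (length t) false) ≡ op w bs ++ t
    op-0-injective : ∀ x w bs bs′ → Unique (x ∷ w) → length bs ≡ length w → length bs′ ≡ length w →
                     op (x ∷ w) (false ∷ bs) ≡ op (x ∷ w) (false ∷ bs′) → bs ≡ bs′
    op-0-displaces : ∀ x w bs → Unique (x ∷ w) → true ∈ bs → length bs ≡ length w →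
                     ∃[ y ] ∃[ l ] (op (x ∷ w) (false ∷ bs) ≡ y ∷ l × y ≢ x)

tdrl-isWindowOp : IsWindowOp {A} tdrl
tdrl-isWindowOp = record
  { op-[] = refl ; op-1∷ = λ _ _ _ → refl ; op-pad = tdrl-pad
  ; op-0-injective = tdrl-0-injective ; op-0-displaces = tdrl-0-displaces }

untdrl-isWindowOp : IsWindowOp {A} untdrl
untdrl-isWindowOp = record
  { op-[] = refl ; op-1∷ = λ _ _ _ → refl ; op-pad = untdrl-pad
  ; op-0-injective = untdrl-0-injective ; op-0-displaces = untdrl-0-displaces }

-- ρ arises from π by applying op to a window of exactly k consecutive entries.
-- By definition, Sout k π ρ is Bounded tdrl k π ρ.
Bounded : (List A → List Bool → List A) → ℕ → List A → List A → Set
Bounded op k π ρ = ∃[ pre ] ∃[ seg ] ∃[ post ] ∃[ bs ]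
  (π ≡ pre ++ seg ++ post × length seg ≡ k × length bs ≡ k × ρ ≡ pre ++ op seg bs ++ post)

Sin⇔untdrl : ∀ n k π ρ → IsPerm n π → Sin n k π ρ ⇔ Bounded untdrl k π ρ
Sin⇔untdrl n k π ρ pπ = mk⇔ to from
  where
  to : Sin n k π ρ → Bounded untdrl k π ρ
  to (_ , pre , seg , post , bs , eρ , ls , lb , eπ) =
    pre , tdrl seg bs , post , bs , eπ , trans (length-tdrl seg bs (trans lb (sym ls))) ls , lb ,
    trans eρ (cong (λ s → pre ++ s ++ post) (sym (untdrl-tdrl seg bs (trans lb (sym ls)))))
  from : Bounded untdrl k π ρ → Sin n k π ρ
  from (pre , seg , post , bs , eπ , ls , lb , eρ) =
    subst (_↭ _) (sym eρ) (↭-trans (++⁺ˡ pre (++⁺ʳ post (untdrl-↭ seg bs))) (subst (_↭ _) eπ pπ)) ,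
    pre , untdrl seg bs , post , bs , eρ , trans (length-untdrl seg bs) ls , lb ,
    trans eπ (cong (λ s → pre ++ s ++ post) (sym (tdrl-untdrl seg bs (trans lb (sym ls)))))

module Enumeration {A : Set} {op : List A → List Bool → List A} (W : IsWindowOp op) (k′ : ℕ) where
  open IsWindowOp W

  headWindow : A → List A → List Bool → List A
  headWindow x π bs = op (x ∷ take k′ π) (false ∷ bs) ++ drop k′ π

  E : List A → List (List A)
  E [] = [] ∷ []
  E (x ∷ π) = map (x ∷_) (E π) ++ map (headWindow x π) (nonzero (length (take k′ π)))

  op-without-one : ∀ s bs → ¬ (true ∈ bs) → length bs ≡ length s → op s bs ≡ s
  op-without-one s bs no-one lb = begin
    op s bs                                ≡⟨ cong (op s) (trans (no-one⇒zeros bs no-one) (cong (λ m → replicate m false) lb)) ⟩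
    op ([] ++ s) (replicate (length s) false) ≡⟨ op-pad [] s [] refl ⟩
    op [] [] ++ s                          ≡⟨ cong (_++ s) op-[] ⟩
    s ∎

  E-self : ∀ π → π ∈ E π
  E-self [] = here refl
  E-self (x ∷ π) = ∈-++⁺ˡ (∈-map⁺ (x ∷_) (E-self π))

  headWindow∈E : ∀ x π bs → true ∈ bs → length bs ≡ length (take k′ π) → headWindow x π bs ∈ E (x ∷ π)
  headWindow∈E x π bs one lb = ∈-++⁺ʳ (map (x ∷_) (E π))
    (∈-map⁺ (headWindow x π) (subst (λ m → bs ∈ nonzero m) lb (nonzero-complete bs one)))

  headWindow-pad : ∀ x w post bs → length bs ≡ length w → length w ≤ k′ →
    let padded = bs ++ replicate (length (take (k′ ∸ length w) post)) false in
    length padded ≡ length (take k′ (w ++ post)) × headWindow x (w ++ post) padded ≡ op (x ∷ w) (false ∷ bs) ++ post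
  headWindow-pad x w post bs lb lw = length-padded , (begin
      op (x ∷ take k′ (w ++ post)) (false ∷ padded) ++ drop k′ (w ++ post)
    ≡⟨ cong₂ (λ s r → op (x ∷ s) (false ∷ padded) ++ r) (take-++-≤ w post k′ lw) (drop-++-≤ w post k′ lw) ⟩
      op ((x ∷ w) ++ t) ((false ∷ bs) ++ replicate (length t) false) ++ d
    ≡⟨ cong (_++ d) (op-pad (x ∷ w) t (false ∷ bs) (cong suc lb)) ⟩
      (op (x ∷ w) (false ∷ bs) ++ t) ++ d
    ≡⟨ ++-assoc (op (x ∷ w) (false ∷ bs)) t d ⟩
      op (x ∷ w) (false ∷ bs) ++ (t ++ d)
    ≡⟨ cong (op (x ∷ w) (false ∷ bs) ++_) (take++drop≡id (k′ ∸ length w) post) ⟩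
      op (x ∷ w) (false ∷ bs) ++ post ∎)
    where
    t = take (k′ ∸ length w) post
    d = drop (k′ ∸ length w) post
    padded = bs ++ replicate (length t) false
    length-padded : length padded ≡ length (take k′ (w ++ post))
    length-padded = begin
      length padded                  ≡⟨ length-++ bs ⟩
      length bs + length (replicate (length t) false) ≡⟨ cong₂ _+_ lb (length-replicate (length t)) ⟩
      length w + length t            ≡⟨ length-++ w ⟨
      length (w ++ t)                ≡⟨ cong length (take-++-≤ w post k′ lw) ⟨
      length (take k′ (w ++ post)) ∎

  E-sound : ∀ pre seg post bs → length bs ≡ length seg → length seg ≤ suc k′ →
            pre ++ op seg bs ++ post ∈ E (pre ++ seg ++ post)
  E-sound (y ∷ pre) seg post bs lb ls = ∈-++⁺ˡ (∈-map⁺ (y ∷_) (E-sound pre seg post bs lb ls))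
  E-sound [] [] post [] _ _ = subst (λ s → s ++ post ∈ E post) (sym op-[]) (E-self post)
  E-sound [] (x ∷ w) post (true ∷ bs) lb ls =
    subst (λ s → s ++ post ∈ E (x ∷ w ++ post)) (sym (op-1∷ x w bs))
      (∈-++⁺ˡ (∈-map⁺ (x ∷_) (E-sound [] w post bs (suc-injective lb) (m≤n⇒m≤1+n (≤-pred ls)))))
  E-sound [] (x ∷ w) post (false ∷ bs) lb ls with true ∈? bs
  ... | no no-one =
    subst (λ s → s ++ post ∈ E (x ∷ w ++ post)) (sym (op-without-one (x ∷ w) (false ∷ bs) no-one′ lb)) (E-self _)
    where
    no-one′ : ¬ (true ∈ false ∷ bs)
    no-one′ (there p) = no-one p
  ... | yes one with headWindow-pad x w post bs (suc-injective lb) (≤-pred ls)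
  ...   | length-padded , same = subst (_∈ E (x ∷ w ++ post)) same (headWindow∈E x (w ++ post) _ (∈-++⁺ˡ one) length-padded)

  Reach : List A → List A → Set
  Reach π ρ = ∃[ pre ] ∃[ seg ] ∃[ post ] ∃[ bs ]
    (π ≡ pre ++ seg ++ post × length bs ≡ length seg × ρ ≡ pre ++ op seg bs ++ post ×
     (length seg ≡ suc k′ ⊎ (pre ≡ [] × post ≡ [] × length seg ≤ k′)))

  -- Keeping a new first entry in front: a short whole-list window absorbs it (with bit 1).
  reach-cons : ∀ x π ρ → Reach π ρ → Reach (x ∷ π) (x ∷ ρ)
  reach-cons x π ρ (pre , seg , post , bs , e , lb , eρ , inj₁ ls) =
    x ∷ pre , seg , post , bs , cong (x ∷_) e , lb , cong (x ∷_) eρ , inj₁ ls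
  reach-cons x π ρ (_ , seg , _ , bs , e , lb , eρ , inj₂ (refl , refl , ls)) =
    [] , x ∷ seg , [] , true ∷ bs , cong (x ∷_) e , cong suc lb ,
    trans (cong (x ∷_) eρ) (cong (_++ []) (sym (op-1∷ x seg bs))) , width (m≤n⇒m<n∨m≡n ls)
    where
    width : length seg < k′ ⊎ length seg ≡ k′ →
            suc (length seg) ≡ suc k′ ⊎ ([] ≡ [] × [] ≡ [] × suc (length seg) ≤ k′)
    width (inj₁ lt) = inj₂ (refl , refl , lt)
    width (inj₂ eq) = inj₁ (cong suc eq)

  reach-headWindow : ∀ x π bs → length bs ≡ length (take k′ π) → Reach (x ∷ π) (headWindow x π bs)
  reach-headWindow x π bs lb =
    [] , x ∷ take k′ π , drop k′ π , false ∷ bs , cong (x ∷_) (sym (take++drop≡id k′ π)) , cong suc lb , refl , width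
    where
    width : suc (length (take k′ π)) ≡ suc k′ ⊎ ([] ≡ [] × drop k′ π ≡ [] × suc (length (take k′ π)) ≤ k′)
    width with k′ ≤? length π
    ... | yes le = inj₁ (cong suc (trans (length-take k′ π) (m≤n⇒m⊓n≡m le)))
    ... | no gt = inj₂ (refl , drop-all k′ π (<⇒≤ (≰⇒> gt)) ,
                        subst (λ s → suc (length s) ≤ k′) (sym (take-all k′ π (<⇒≤ (≰⇒> gt)))) (≰⇒> gt))

  E-complete : ∀ π ρ → ρ ∈ E π → Reach π ρ
  E-complete [] ρ (here refl) = [] , [] , [] , [] , refl , refl , cong (_++ []) (sym op-[]) , inj₂ (refl , refl , z≤n)
  E-complete (x ∷ π) ρ ρ∈ with ∈-++⁻ (map (x ∷_) (E π)) ρ∈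
  ... | inj₁ kept with ∈-map⁻ (x ∷_) kept
  ...   | ρ′ , ρ′∈ , refl = reach-cons x π ρ′ (E-complete π ρ′ ρ′∈)
  E-complete (x ∷ π) ρ ρ∈ | inj₂ moved with ∈-map⁻ (headWindow x π) moved
  ...   | bs , bs∈ , refl = reach-headWindow x π bs (nonzero-length _ bs∈)

  E-Unique : ∀ π → Unique π → Unique (E π)
  E-Unique [] _ = [] ∷ []
  E-Unique (x ∷ π) u@(_ ∷ uπ) =
    Unique.++⁺ (Unique.map⁺ ∷-injectiveʳ (E-Unique π uπ))
               (map-Unique (headWindow x π) (nonzero m) injective (nonzero-Unique m)) apart
    where
    m = length (take k′ π)
    uw : Unique (x ∷ take k′ π)
    uw = Unique.take⁺ (suc k′) u
    injective : ∀ {bs bs′} → bs ∈ nonzero m → bs′ ∈ nonzero m →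
                headWindow x π bs ≡ headWindow x π bs′ → bs ≡ bs′
    injective bs∈ bs′∈ e = op-0-injective x (take k′ π) _ _ uw (nonzero-length m bs∈) (nonzero-length m bs′∈)
                             (++-cancelʳ (drop k′ π) _ _ e)
    -- head windows move x away from the front
    apart : ∀ {v} → ¬ (v ∈ map (x ∷_) (E π) × v ∈ map (headWindow x π) (nonzero m))
    apart (p , q) with ∈-map⁻ (x ∷_) p | ∈-map⁻ (headWindow x π) q
    ... | ρ′ , _ , refl | bs , bs∈ , e
          with op-0-displaces x (take k′ π) bs uw (nonzero-has-one m bs∈) (nonzero-length m bs∈)
    ...   | y , l , e′ , y≢x = y≢x (∷-injectiveˡ (trans (sym (cong (_++ drop k′ π) e′)) (sym e)))

  E-length-cons : ∀ x π → length (E (x ∷ π)) ≡ length (E π) + length (nonzero (length (take k′ π)))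
  E-length-cons x π = trans (length-++ (map (x ∷_) (E π)))
    (cong₂ _+_ (length-map (x ∷_) (E π)) (length-map (headWindow x π) (nonzero (length (take k′ π)))))

  E-length-short : ∀ π → length π ≤ suc k′ → length (E π) + length π ≡ 2 ^ length π
  E-length-short [] _ = refl
  E-length-short (x ∷ π) (s≤s le) = begin
      length (E (x ∷ π)) + suc m
    ≡⟨ cong (_+ suc m) (E-length-cons x π) ⟩
      length (E π) + length (nonzero (length (take k′ π))) + suc m
    ≡⟨ cong (λ s → length (E π) + length (nonzero (length s)) + suc m) (take-all k′ π le) ⟩
      length (E π) + length (nonzero m) + suc m
    ≡⟨ exchange (length (E π)) (length (nonzero m)) m ⟩
      (length (E π) + m) + suc (length (nonzero m))
    ≡⟨ cong₂ _+_ (E-length-short π (m≤n⇒m≤1+n le)) (nonzero-count m) ⟩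
      2 ^ m + 2 ^ m
    ≡⟨ cong (2 ^ m +_) (+-identityʳ (2 ^ m)) ⟨
      2 ^ suc m ∎
    where
    m = length π
    open +-*-Solver
    exchange : ∀ a z m → a + z + suc m ≡ (a + m) + suc z
    exchange = solve 3 (λ a z m → a :+ z :+ (con 1 :+ m) := (a :+ m) :+ (con 1 :+ z)) refl

  -- For a list of length k + d, each of the d entries beyond the first window adds
  -- 2^k′ − 1 = |nonzero k′| results.
  E-length-long : ∀ d π → length π ≡ suc k′ + d → length (E π) + suc k′ ≡ (d + 2) * length (nonzero k′) + 2
  E-length-long zero π eq = begin
      length (E π) + suc k′        ≡⟨ cong (length (E π) +_) lπ ⟨
      length (E π) + length π      ≡⟨ E-length-short π (≤-reflexive lπ) ⟩
      2 ^ length π                 ≡⟨ cong (2 ^_) lπ ⟩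
      2 * 2 ^ k′                   ≡⟨ cong (2 *_) (nonzero-count k′) ⟨
      2 * suc p                    ≡⟨ double p ⟩
      (0 + 2) * p + 2 ∎
    where
    p = length (nonzero k′)
    lπ : length π ≡ suc k′
    lπ = trans eq (+-identityʳ (suc k′))
    open +-*-Solver
    double : ∀ p → 2 * suc p ≡ (0 + 2) * p + 2
    double = solve 1 (λ p → con 2 :* (con 1 :+ p) := (con 0 :+ con 2) :* p :+ con 2) refl
  E-length-long (suc d) (x ∷ π) eq = begin
      length (E (x ∷ π)) + suc k′
    ≡⟨ cong (_+ suc k′) (E-length-cons x π) ⟩
      length (E π) + length (nonzero (length (take k′ π))) + suc k′
    ≡⟨ cong (λ m → length (E π) + length (nonzero m) + suc k′) full ⟩
      length (E π) + p + suc k′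
    ≡⟨ exchange (length (E π)) p (suc k′) ⟩
      length (E π) + suc k′ + p
    ≡⟨ cong (_+ p) (E-length-long d π lπ) ⟩
      (d + 2) * p + 2 + p
    ≡⟨ one-more d p ⟩
      (suc d + 2) * p + 2 ∎
    where
    p = length (nonzero k′)
    lπ : length π ≡ suc k′ + d
    lπ = trans (suc-injective eq) (+-suc k′ d)
    full : length (take k′ π) ≡ k′
    full = trans (length-take k′ π) (m≤n⇒m⊓n≡m (subst (k′ ≤_) (sym lπ) (m≤n⇒m≤1+n (m≤m+n k′ d))))
    open +-*-Solver
    exchange : ∀ a p s → a + p + s ≡ a + s + p
    exchange = solve 3 (λ a p s → a :+ p :+ s := a :+ s :+ p) refl
    one-more : ∀ d p → (d + 2) * p + 2 + p ≡ (suc d + 2) * p + 2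
    one-more = solve 2 (λ d p → (d :+ con 2) :* p :+ con 2 :+ p := ((con 1 :+ d) :+ con 2) :* p :+ con 2) refl

  E-size : ∀ d π → length π ≡ suc k′ + d → length (E π) ≡ (d + 2) * (2 ^ k′ ∸ 1) + 2 ∸ suc k′
  E-size d π eq = begin
    length (E π)                                   ≡⟨ m+n∸n≡m (length (E π)) (suc k′) ⟨
    length (E π) + suc k′ ∸ suc k′                 ≡⟨ cong (_∸ suc k′) (E-length-long d π eq) ⟩
    (d + 2) * length (nonzero k′) + 2 ∸ suc k′     ≡⟨ cong (λ q → (d + 2) * (q ∸ 1) + 2 ∸ suc k′) (nonzero-count k′) ⟩
    (d + 2) * (2 ^ k′ ∸ 1) + 2 ∸ suc k′ ∎

  E-exact : ∀ π ρ → suc k′ ≤ length π → (ρ ∈ E π) ⇔ Bounded op (suc k′) π ρ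
  E-exact π ρ long = mk⇔ to from
    where
    to : ρ ∈ E π → Bounded op (suc k′) π ρ
    to ρ∈ with E-complete π ρ ρ∈
    ... | pre , seg , post , bs , e , lb , eρ , inj₁ ls = pre , seg , post , bs , e , ls , trans lb ls , eρ
    ... | _ , seg , _ , bs , e , lb , eρ , inj₂ (refl , refl , ls) =
      ⊥-elim (1+n≰n (≤-trans long (subst (_≤ k′) (sym (cong length (trans e (++-identityʳ seg)))) ls)))
    from : Bounded op (suc k′) π ρ → ρ ∈ E π
    from (pre , seg , post , bs , e , ls , lb , eρ) =
      subst₂ (λ r s → r ∈ E s) (sym eρ) (sym e) (E-sound pre seg post bs (trans lb (sym ls)) (≤-reflexive ls))

bounded-size : {op : List ℕ → List Bool → List ℕ} → IsWindowOp op →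
               ∀ k′ n π → Unique π → length π ≡ n → suc k′ ≤ n →
               HasSize (Bounded op (suc k′) π) ((n ∸ suc k′ + 2) * (2 ^ k′ ∸ 1) + 2 ∸ suc k′)
bounded-size W k′ n π u lπ k≤n =
  E π , E-Unique π u , (λ ρ → E-exact π ρ (subst (suc k′ ≤_) (sym lπ) k≤n)) ,
  E-size (n ∸ suc k′) π (trans lπ (sym (m+[n∸m]≡n k≤n)))
  where open Enumeration W k′

HasSize-resp : {P Q : List ℕ → Set} {N : ℕ} → (∀ ρ → P ρ ⇔ Q ρ) → HasSize P N → HasSize Q N
HasSize-resp P⇔Q (xs , u , mem , len) = xs , u , (λ ρ → ⇔-trans (mem ρ) (P⇔Q ρ)) , len

IsPerm-Unique : ∀ {n π} → IsPerm n π → Unique π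
IsPerm-Unique {n} pπ = Unique-resp-↭ (↭-sym pπ) (Unique.map⁺ suc-injective (Unique.upTo⁺ n))

IsPerm-length : ∀ {n π} → IsPerm n π → length π ≡ n
IsPerm-length {n} pπ = trans (↭-length pπ) (trans (length-map suc (upTo n)) (length-upTo n))

theorem4 : (n k : ℕ) → 1 ≤ k → k ≤ n → (π : List ℕ) → IsPerm n π →
    HasSize (Sout k π) ((n ∸ k + 2) * (2 ^ (k ∸ 1) ∸ 1) + 2 ∸ k)
    × HasSize (Sin n k π) ((n ∸ k + 2) * (2 ^ (k ∸ 1) ∸ 1) + 2 ∸ k)
theorem4 n (suc k′) (s≤s z≤n) k≤n π pπ =
  bounded-size tdrl-isWindowOp k′ n π (IsPerm-Unique pπ) (IsPerm-length pπ) k≤n ,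
  HasSize-resp (λ ρ → ⇔-sym (Sin⇔untdrl n (suc k′) π ρ pπ))
    (bounded-size untdrl-isWindowOp k′ n π (IsPerm-Unique pπ) (IsPerm-length pπ) k≤n)
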